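{- Assume the following statement (H) holds: for every integer $\ell\ge 1$, every $n$ with $2^n\ge\ell$, and every set $S\subseteq\mathbb{F}_2^n$ of $\ell$ cards that is not contained in any complete set of $2^{\lceil\log_2\ell\rceil}$ cards of $\mathbb{F}_2^n$, the number of quads in $S$ is at most $Q(\ell-1)$. For $n\ge 0$ let $P(n)=Q(n+1)-Q(n)$. Then for every integer $n\ge 0$, \[P(n)=\frac{n^2-B(n)}{4},\] where $B(n)$ is the integer obtained by writing $n$ in binary and reading the resulting digit string in base $4$ (i.e. if $n=\sum_i b_i2^i$ with $b_i\in\{0,1\}$, then $B(n)=\sum_i b_i4^i$).
   Context: An EvenQuads deck of size $2^n$ is the set $\mathbb{F}_2^n$; its elements are called cards. A quad is a $4$-element subset $\{a,b,c,d\}$ of the deck with $a+b+c+d=0$. The number of quads in a set of cards is the number of its $4$-element subsets that are quads. A set $S$ of cards is complete if for any three distinct $a,b,c\in S$ the card $a+b+c$ also lies in $S$. For $\ell\ge 0$, $Q(\ell)$ is the maximum, over all $n$ with $2^n\ge\ell$ and all $\ell$-element subsets of $\mathbb{F}_2^n$, of the number of quads in the subset. -}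

module Defs where

open import Data.Bool using (Bool; true; false; _xor_; not)
open import Data.Nat using (ℕ; zero; suc; _+_; _*_; _∸_; _^_; _≤_; _≥_; _/_; _%_)
open import Data.Nat.Logarithm using (⌈log₂_⌉)
open import Data.List using (List; []; _∷_; length; map; filter; upTo; foldr)
open import Data.Nat.ListAction using (sum)
open import Data.List.Relation.Unary.All using (All)
open import Data.List.Relation.Unary.Unique.Propositional using (Unique)
open import Data.List.Membership.Propositional using (_∈_)
open import Data.Vec using (Vec; replicate; zipWith)
open import Data.Vec.Properties using (≡-dec)
import Data.Bool.Properties as BP
open import Data.Product using (Σ; _×_; _,_; ∃)
open import Relation.Binary.PropositionalEquality using (_≡_; _≢_)
open import Relation.Nullary using (¬_)

Card : ℕ → Set
Card n = Vec Bool n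

_⊕_ : ∀ {n} → Card n → Card n → Card n
_⊕_ = zipWith _xor_

𝟘 : ∀ {n} → Card n
𝟘 = replicate _ false

sumCards : ∀ {n} → List (Card n) → Card n
sumCards = foldr _⊕_ 𝟘

-- All k-element sublists (= k-element subsets, if the list has no duplicates).
subsets : ∀ {A : Set} → ℕ → List A → List (List A)
subsets zero    _        = [] ∷ []
subsets (suc k) []       = []
subsets (suc k) (x ∷ xs) = map (x ∷_) (subsets k xs) ++ subsets (suc k) xs
  where open import Data.List using (_++_)

CardSet : ℕ → Set
CardSet n = Σ (List (Card n)) Unique

numQuads : ∀ {n} → List (Card n) → ℕ
numQuads S = length (filter (λ T → ≡-dec BP._≟_ (sumCards T) 𝟘) (subsets 4 S))

Complete : ∀ {n} → List (Card n) → Set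
Complete T = ∀ a b c → a ∈ T → b ∈ T → c ∈ T →
             a ≢ b → a ≢ c → b ≢ c → (a ⊕ (b ⊕ c)) ∈ T

IsQ : ℕ → ℕ → Set
IsQ ℓ q =
  (∃ λ n → 2 ^ n ≥ ℓ × ∃ λ (S : List (Card n)) → Unique S × length S ≡ ℓ × numQuads S ≡ q)
  × (∀ n → 2 ^ n ≥ ℓ → (S : List (Card n)) → Unique S → length S ≡ ℓ → numQuads S ≤ q)

HypH : Set
HypH = ∀ ℓ → 1 ≤ ℓ → ∀ n → 2 ^ n ≥ ℓ → (S : List (Card n)) → Unique S → length S ≡ ℓ →
       (¬ ∃ λ (T : List (Card n)) → Unique T × length T ≡ 2 ^ ⌈log₂ ℓ ⌉ × Complete T × All (_∈ T) S) →
       ∀ q → IsQ (ℓ ∸ 1) q → numQuads S ≤ q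

-- B(n): binary digits of n read in base 4, B(n) = Σ_i b_i 4^i (bits with i > n vanish).
-- ⌊n / 2^i⌋ by repeated halving.
shiftR : ℕ → ℕ → ℕ
shiftR zero    n = n
shiftR (suc i) n = shiftR i (n / 2)

bit : ℕ → ℕ → ℕ
bit i n = shiftR i n % 2

B : ℕ → ℕ
B n = sum (map (λ i → bit i n * 4 ^ i) (upTo (suc n)))

-- F ℓ = Σ_{j<ℓ} (j² − B j) equals 4·Q(ℓ), which is the claimed recurrence. Counting the ordered quadruples of
-- zero sum with the symmetric 4-linear form (a,b,c,d) ↦ [a+b+c+d = 0] shows that if S and C partition a complete
-- set of 2ᵏ cards then 4·q(S) − F|S| = 4·q(C) − F|C|: the quadruple counts give a polynomial identity in |S|, |C|,
-- and moving one card at a time from C to S reduces the F-side to B ℓ + B m = (4ᵏ − 1)/3 whenever ℓ + m = 2ᵏ − 1,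
-- i.e. whenever m is the k-bit complement of ℓ. Equality 4·q(S) = F|S| is then attained by sets built recursively by
-- embedding from 𝔽₂ᵏ⁻¹ or complementing in 𝔽₂ᵏ, and the bound 4·q(S) ≤ F|S| follows by induction on |S|: either S
-- lies in a complete set of 2^⌈log₂|S|⌉ < 2|S| cards and its smaller complement there transfers the bound, or (H)
-- reduces to |S| − 1 cards.
module Submission where

open import Defs
open import Data.Bool using (true; false)
import Data.Bool.Properties as Bool
open import Data.Nat using (ℕ; zero; suc; _+_; _*_; _∸_; _^_; _≤_; _<_; _≥_; _≤?_; _/_; _%_; z≤n; s≤s)
open import Data.Nat.Properties hiding (_≟_)
open import Data.Nat.DivMod using (m≡m%n+[m/n]*n; m<n*o⇒m/o<n; m/n≤m; m*n%n≡0; m*n/n≡m; [m+kn]%n≡m%n; +-distrib-/-∣ʳ)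
open import Data.Nat.Divisibility using (n∣m*n)
open import Data.Nat.ListAction using (sum)
open import Data.Nat.Tactic.RingSolver using (solve-∀)
open import Data.Nat.Induction using (<-rec)
open import Data.Nat.Logarithm using (⌈log₂_⌉; ⌈log₂⌉-mono-≤; ⌈log₂2^n⌉≡n)
open import Data.Empty using (⊥-elim)
open import Data.Vec using ([]; _∷_)
open import Data.Vec.Properties using (≡-dec; zipWith-assoc; zipWith-comm; zipWith-identityˡ; zipWith-identityʳ; ∷-injectiveʳ)
open import Data.List using (List; []; _∷_; _++_; length; map; filter; applyUpTo)
open import Data.List.Properties using (length-++; length-map; filter-++; filter-≐; map-applyUpTo)
open import Data.List.Membership.Propositional using (_∈_; _∉_)
open import Data.List.Relation.Unary.Any using (here; there)
open import Data.List.Relation.Unary.All as All using ()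
open import Data.List.Relation.Unary.AllPairs using ([]; _∷_)
open import Data.List.Relation.Unary.Unique.Propositional using (Unique)
open import Data.List.Relation.Unary.Unique.Propositional.Properties using (map⁺; ++⁺; filter⁺)
open import Data.List.Membership.Propositional.Properties using (∈-map⁺; ∈-map⁻; ∈-++⁺ˡ; ∈-++⁺ʳ)
import Data.List.Membership.DecPropositional as DecMembership
open import Data.Sum using (_⊎_; inj₁; inj₂)
open import Data.Product using (Σ; ∃; _×_; _,_)
open import Relation.Binary.PropositionalEquality
open import Relation.Nullary using (¬_; ¬?; Dec; yes; no; contradiction)
open import Relation.Nullary.Decidable using (decidable-stable)
open import Relation.Unary using (Decidable)

variable n : ℕ

-- Binary digits read in base 4

data EvenOdd : ℕ → Set where
  even : ∀ a → EvenOdd (2 * a)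
  odd  : ∀ a → EvenOdd (1 + 2 * a)

evenOdd : ∀ n → EvenOdd n
evenOdd zero = even 0
evenOdd (suc n) with evenOdd n
... | even a = odd a
... | odd a  = subst EvenOdd (cong suc (+-suc a (a + 0))) (even (suc a))

n<2^n : ∀ n → n < 2 ^ n
n<2^n zero    = s≤s z≤n
n<2^n (suc n) = begin-strict
  suc n         ≡⟨ +-comm 1 n ⟩
  n + 1         <⟨ +-mono-<-≤ (n<2^n n) (m^n>0 2 n) ⟩
  2 ^ n + 2 ^ n ≡⟨ cong (2 ^ n +_) (sym (+-identityʳ (2 ^ n))) ⟩
  2 ^ suc n     ∎
  where open ≤-Reasoning

truncatedB : ℕ → ℕ → ℕ
truncatedB zero    n = 0
truncatedB (suc K) n = n % 2 + 4 * truncatedB K (n / 2)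

sum-applyUpTo-cong : ∀ {f g : ℕ → ℕ} K → (∀ i → f i ≡ g i) → sum (applyUpTo f K) ≡ sum (applyUpTo g K)
sum-applyUpTo-cong zero    f≗g = refl
sum-applyUpTo-cong (suc K) f≗g = cong₂ _+_ (f≗g 0) (sum-applyUpTo-cong K (λ i → f≗g (suc i)))

digitSum≡truncatedB : ∀ c K n → sum (applyUpTo (λ i → bit i n * (c * 4 ^ i)) K) ≡ c * truncatedB K n
digitSum≡truncatedB c zero    n = sym (*-zeroʳ c)
digitSum≡truncatedB c (suc K) n = begin
  n % 2 * (c * 1) + sum (applyUpTo (λ i → bit i (n / 2) * (c * (4 * 4 ^ i))) K)
    ≡⟨ cong (n % 2 * (c * 1) +_) (sum-applyUpTo-cong K (λ i → cong (bit i (n / 2) *_) (sym (*-assoc c 4 (4 ^ i))))) ⟩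
  n % 2 * (c * 1) + sum (applyUpTo (λ i → bit i (n / 2) * (c * 4 * 4 ^ i)) K)
    ≡⟨ cong (n % 2 * (c * 1) +_) (digitSum≡truncatedB (c * 4) K (n / 2)) ⟩
  n % 2 * (c * 1) + c * 4 * truncatedB K (n / 2)
    ≡⟨ regroup (n % 2) c (truncatedB K (n / 2)) ⟩
  c * truncatedB (suc K) n ∎
  where
  open ≡-Reasoning
  regroup : ∀ r c t → r * (c * 1) + c * 4 * t ≡ c * (r + 4 * t)
  regroup = solve-∀

truncatedB-zero : ∀ K → truncatedB K 0 ≡ 0
truncatedB-zero zero    = refl
truncatedB-zero (suc K) = cong (4 *_) (truncatedB-zero K)

half<2^ : ∀ {n} K → n < 2 ^ suc K → n / 2 < 2 ^ K
half<2^ {n} K n<2^K+1 = m<n*o⇒m/o<n (subst (n <_) (*-comm 2 (2 ^ K)) n<2^K+1)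

truncatedB-stable : ∀ K K′ {n} → n < 2 ^ K → n < 2 ^ K′ → truncatedB K n ≡ truncatedB K′ n
truncatedB-stable zero    K′      (s≤s z≤n) _         = sym (truncatedB-zero K′)
truncatedB-stable (suc K) zero    _         (s≤s z≤n) = truncatedB-zero (suc K)
truncatedB-stable (suc K) (suc K′) {n} n<2^K n<2^K′ =
  cong (λ t → n % 2 + 4 * t) (truncatedB-stable K K′ (half<2^ K n<2^K) (half<2^ K′ n<2^K′))

B≡truncatedB[1+n] : ∀ n → B n ≡ truncatedB (suc n) n
B≡truncatedB[1+n] n = begin
  B n                                                      ≡⟨ cong sum (map-applyUpTo (λ i → i) _ (suc n)) ⟩
  sum (applyUpTo (λ i → bit i n * 4 ^ i) (suc n))          ≡⟨ sum-applyUpTo-cong (suc n) (λ i → cong (bit i n *_) (sym (*-identityˡ (4 ^ i)))) ⟩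
  sum (applyUpTo (λ i → bit i n * (1 * 4 ^ i)) (suc n))    ≡⟨ digitSum≡truncatedB 1 (suc n) n ⟩
  1 * truncatedB (suc n) n                                 ≡⟨ *-identityˡ _ ⟩
  truncatedB (suc n) n                                     ∎
  where open ≡-Reasoning

B≡truncatedB : ∀ K {n} → n < 2 ^ K → B n ≡ truncatedB K n
B≡truncatedB K {n} n<2^K =
  trans (B≡truncatedB[1+n] n) (truncatedB-stable (suc n) K (<-trans (n<1+n n) (n<2^n (suc n))) n<2^K)

B-half : ∀ n → B n ≡ n % 2 + 4 * B (n / 2)
B-half n = begin
  B n                                  ≡⟨ B≡truncatedB[1+n] n ⟩
  n % 2 + 4 * truncatedB n (n / 2)     ≡⟨ cong (λ t → n % 2 + 4 * t) (B≡truncatedB n (≤-<-trans (m/n≤m n 2) (n<2^n n))) ⟨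
  n % 2 + 4 * B (n / 2)                ∎
  where open ≡-Reasoning

B-double : ∀ a → B (2 * a) ≡ 4 * B a
B-double a = begin
  B (2 * a)                            ≡⟨ cong B (*-comm 2 a) ⟩
  B (a * 2)                            ≡⟨ B-half (a * 2) ⟩
  a * 2 % 2 + 4 * B (a * 2 / 2)        ≡⟨ cong₂ (λ r h → r + 4 * B h) (m*n%n≡0 a 2) (m*n/n≡m a 2) ⟩
  4 * B a                              ∎
  where open ≡-Reasoning

B-double+1 : ∀ a → B (1 + 2 * a) ≡ 1 + 4 * B a
B-double+1 a = begin
  B (1 + 2 * a)                        ≡⟨ cong (λ t → B (1 + t)) (*-comm 2 a) ⟩
  B (1 + a * 2)                        ≡⟨ B-half (1 + a * 2) ⟩
  (1 + a * 2) % 2 + 4 * B ((1 + a * 2) / 2)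
    ≡⟨ cong₂ (λ r h → r + 4 * B h) ([m+kn]%n≡m%n 1 a 2) (trans (+-distrib-/-∣ʳ 1 {d = 2} (n∣m*n a)) (m*n/n≡m a 2)) ⟩
  1 + 4 * B a                          ∎
  where open ≡-Reasoning

truncatedB≤square : ∀ K n → truncatedB K n ≤ n * n
truncatedB≤square zero    n = z≤n
truncatedB≤square (suc K) n = begin
  n % 2 + 4 * truncatedB K (n / 2)           ≤⟨ +-monoʳ-≤ (n % 2) (*-monoʳ-≤ 4 (truncatedB≤square K (n / 2))) ⟩
  n % 2 + 4 * (n / 2 * (n / 2))              ≤⟨ digits-bound (n % 2) (n / 2) ⟩
  (n % 2 + n / 2 * 2) * (n % 2 + n / 2 * 2)  ≡⟨ cong (λ t → t * t) (sym (m≡m%n+[m/n]*n n 2)) ⟩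
  n * n                                      ∎
  where
  open ≤-Reasoning
  m≤m*m : ∀ m → m ≤ m * m
  m≤m*m zero    = z≤n
  m≤m*m (suc m) = m≤m*n (suc m) (suc m)
  expand : ∀ r h → r * r + 4 * (h * h) + 4 * (r * h) ≡ (r + h * 2) * (r + h * 2)
  expand = solve-∀
  digits-bound : ∀ r h → r + 4 * (h * h) ≤ (r + h * 2) * (r + h * 2)
  digits-bound r h = begin
    r + 4 * (h * h)                     ≤⟨ +-monoˡ-≤ (4 * (h * h)) (m≤m*m r) ⟩
    r * r + 4 * (h * h)                 ≤⟨ m≤m+n _ (4 * (r * h)) ⟩
    r * r + 4 * (h * h) + 4 * (r * h)   ≡⟨ expand r h ⟩
    (r + h * 2) * (r + h * 2)           ∎

B≤square : ∀ n → B n ≤ n * n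
B≤square n = ≤-trans (≤-reflexive (B≡truncatedB[1+n] n)) (truncatedB≤square (suc n) n)

square-double : ∀ p → 4 * (p * p) ≡ 2 * p * (2 * p)
square-double = solve-∀

-- If ℓ + m = 2ᵏ - 1 then m is the k-bit complement of ℓ, so B ℓ + B m = (4ᵏ - 1)/3.
B-complement : ∀ k ℓ m → ℓ + suc m ≡ 2 ^ k → 3 * (B ℓ + B m) + 1 ≡ 2 ^ k * 2 ^ k
B-complement zero    zero    zero    _  = refl
B-complement zero    zero    (suc m) ()
B-complement zero    (suc ℓ) m       e  = ⊥-elim (m+1+n≢0 ℓ (suc-injective e))
B-complement (suc k) ℓ       m       e with evenOdd ℓ | evenOdd m
... | even a | even b = ⊥-elim (even≢odd (2 ^ k) (a + b) (trans (sym e) (even+odd a b)))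
  where
  even+odd : ∀ a b → 2 * a + suc (2 * b) ≡ suc (2 * (a + b))
  even+odd = solve-∀
... | odd a  | odd b  = ⊥-elim (even≢odd (2 ^ k) (suc (a + b)) (trans (sym e) (odd+odd a b)))
  where
  odd+odd : ∀ a b → 1 + 2 * a + suc (1 + 2 * b) ≡ suc (2 * suc (a + b))
  odd+odd = solve-∀
... | even a | odd b  = begin
  3 * (B (2 * a) + B (1 + 2 * b)) + 1   ≡⟨ cong₂ (λ x y → 3 * (x + y) + 1) (B-double a) (B-double+1 b) ⟩
  3 * (4 * B a + (1 + 4 * B b)) + 1     ≡⟨ regroup (B a) (B b) ⟩
  4 * (3 * (B a + B b) + 1)             ≡⟨ cong (4 *_) (B-complement k a b (*-cancelˡ-≡ _ _ 2 (trans (halves a b) e))) ⟩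
  4 * (2 ^ k * 2 ^ k)                   ≡⟨ square-double (2 ^ k) ⟩
  2 ^ suc k * 2 ^ suc k                 ∎
  where
  open ≡-Reasoning
  regroup : ∀ x y → 3 * (4 * x + (1 + 4 * y)) + 1 ≡ 4 * (3 * (x + y) + 1)
  regroup = solve-∀
  halves : ∀ a b → 2 * (a + suc b) ≡ 2 * a + suc (1 + 2 * b)
  halves = solve-∀
... | odd a  | even b = begin
  3 * (B (1 + 2 * a) + B (2 * b)) + 1   ≡⟨ cong₂ (λ x y → 3 * (x + y) + 1) (B-double+1 a) (B-double b) ⟩
  3 * (1 + 4 * B a + 4 * B b) + 1       ≡⟨ regroup (B a) (B b) ⟩
  4 * (3 * (B a + B b) + 1)             ≡⟨ cong (4 *_) (B-complement k a b (*-cancelˡ-≡ _ _ 2 (trans (halves a b) e))) ⟩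
  4 * (2 ^ k * 2 ^ k)                   ≡⟨ square-double (2 ^ k) ⟩
  2 ^ suc k * 2 ^ suc k                 ∎
  where
  open ≡-Reasoning
  regroup : ∀ x y → 3 * (1 + 4 * x + 4 * y) + 1 ≡ 4 * (3 * (x + y) + 1)
  regroup = solve-∀
  halves : ∀ a b → 2 * (a + suc b) ≡ 1 + 2 * a + suc (2 * b)
  halves = solve-∀

-- The truncated subtraction never truncates, as B j ≤ j * j (see F-suc).
F : ℕ → ℕ
F zero    = 0
F (suc j) = F j + (j * j ∸ B j)

F-suc : ∀ j → F (suc j) + B j ≡ F j + j * j
F-suc j = trans (+-assoc (F j) (j * j ∸ B j) (B j)) (cong (F j +_) (m∸n+n≡m (B≤square j)))

cubic : ℕ → ℕ → ℕ
cubic ℓ m = 3 * (ℓ * ℓ) + 2 * m + m * (ℓ * ℓ) + m * (m * m)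

-- Its symmetry when ℓ + m = 2ᵏ is what the complement identity numQuads-partition needs from F.
balance : ℕ → ℕ → ℕ
balance ℓ m = 6 * F ℓ + cubic ℓ m

balance-step : ∀ k ℓ m → ℓ + suc m ≡ 2 ^ k →
               balance ℓ (suc m) + balance m (suc ℓ) ≡ balance (suc ℓ) m + balance (suc m) ℓ
balance-step k ℓ m e = +-cancelʳ-≡ (2 * (3 * (B ℓ + B m) + 1)) _ _ (begin
  balance ℓ (suc m) + balance m (suc ℓ) + 2 * (3 * (B ℓ + B m) + 1)
    ≡⟨ cong (λ t → balance ℓ (suc m) + balance m (suc ℓ) + 2 * t) (trans (B-complement k ℓ m e) (cong (λ t → t * t) (sym e))) ⟩
  balance ℓ (suc m) + balance m (suc ℓ) + 2 * ((ℓ + suc m) * (ℓ + suc m))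
    ≡⟨ expand (F ℓ) (F m) ℓ m ⟩
  6 * (F ℓ + ℓ * ℓ) + 6 * (F m + m * m) + (cubic (suc ℓ) m + cubic (suc m) ℓ + 2)
    ≡⟨ cong₂ (λ x y → 6 * x + 6 * y + (cubic (suc ℓ) m + cubic (suc m) ℓ + 2)) (sym (F-suc ℓ)) (sym (F-suc m)) ⟩
  6 * (F (suc ℓ) + B ℓ) + 6 * (F (suc m) + B m) + (cubic (suc ℓ) m + cubic (suc m) ℓ + 2)
    ≡⟨ collect (F (suc ℓ)) (F (suc m)) (B ℓ) (B m) (cubic (suc ℓ) m) (cubic (suc m) ℓ) ⟩
  balance (suc ℓ) m + balance (suc m) ℓ + 2 * (3 * (B ℓ + B m) + 1) ∎)
  where
  open ≡-Reasoning
  expand : ∀ f g l m →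
    6 * f + (3 * (l * l) + 2 * suc m + suc m * (l * l) + suc m * (suc m * suc m)) +
    (6 * g + (3 * (m * m) + 2 * suc l + suc l * (m * m) + suc l * (suc l * suc l))) + 2 * ((l + suc m) * (l + suc m))
    ≡ 6 * (f + l * l) + 6 * (g + m * m) +
      (3 * (suc l * suc l) + 2 * m + m * (suc l * suc l) + m * (m * m) +
       (3 * (suc m * suc m) + 2 * l + l * (suc m * suc m) + l * (l * l)) + 2)
  expand = solve-∀
  collect : ∀ f g b c r s → 6 * (f + b) + 6 * (g + c) + (r + s + 2) ≡ 6 * f + r + (6 * g + s) + 2 * (3 * (b + c) + 1)
  collect = solve-∀

balance-telescope : ∀ k ℓ m → ℓ + m ≡ 2 ^ k → balance ℓ m + balance 0 (2 ^ k) ≡ balance m ℓ + balance (2 ^ k) 0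
balance-telescope k ℓ zero e with trans (sym (+-identityʳ ℓ)) e
... | refl = +-comm (balance ℓ 0) (balance 0 ℓ)
balance-telescope k ℓ (suc m) e =
  exchange (balance ℓ (suc m)) (balance (suc m) ℓ) (balance (suc ℓ) m) (balance (2 ^ k) 0)
           (balance 0 (2 ^ k)) (balance m (suc ℓ))
           (balance-step k ℓ m e) (balance-telescope k (suc ℓ) m (trans (sym (+-suc ℓ m)) e))
  where
  exchange : ∀ a b c d x y → a + y ≡ c + b → c + x ≡ y + d → a + x ≡ b + d
  exchange a b c d x y ay≡cb cx≡yd = +-cancelʳ-≡ y _ _ (begin
    a + x + y   ≡⟨ +-assoc a x y ⟩
    a + (x + y) ≡⟨ cong (a +_) (+-comm x y) ⟩
    a + (y + x) ≡⟨ +-assoc a y x ⟨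
    a + y + x   ≡⟨ cong (_+ x) ay≡cb ⟩
    c + b + x   ≡⟨ cong (_+ x) (+-comm c b) ⟩
    b + c + x   ≡⟨ +-assoc b c x ⟩
    b + (c + x) ≡⟨ cong (b +_) cx≡yd ⟩
    b + (y + d) ≡⟨ cong (b +_) (+-comm y d) ⟩
    b + (d + y) ≡⟨ +-assoc b d y ⟨
    b + d + y   ∎)
    where open ≡-Reasoning

balance-symmetric : ∀ k ℓ m → ℓ + m ≡ 2 ^ k → balance ℓ m ≡ balance m ℓ
balance-symmetric k ℓ m e = +-cancelʳ-≡ (balance 0 (2 ^ k)) _ _
  (trans (balance-telescope k ℓ m e) (cong (balance m ℓ +_) (sym ends-agree)))
  where
  ends-agree : balance 0 (2 ^ k) ≡ balance (2 ^ k) 0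
  ends-agree = double-injective (balance-telescope k 0 (2 ^ k) refl)
    where
    double-injective : ∀ {a b} → a + a ≡ b + b → a ≡ b
    double-injective {a} {b} e = *-cancelˡ-≡ a b 2
      (trans (cong (a +_) (+-identityʳ a)) (trans e (cong (b +_) (sym (+-identityʳ b)))))

-- The group 𝔽₂ⁿ and sums over it

⊕-assoc : (x y z : Card n) → (x ⊕ y) ⊕ z ≡ x ⊕ (y ⊕ z)
⊕-assoc = zipWith-assoc Bool.xor-assoc

⊕-comm : (x y : Card n) → x ⊕ y ≡ y ⊕ x
⊕-comm = zipWith-comm Bool.xor-comm

⊕-identityˡ : (x : Card n) → 𝟘 ⊕ x ≡ x
⊕-identityˡ = zipWith-identityˡ Bool.xor-identityˡ

⊕-identityʳ : (x : Card n) → x ⊕ 𝟘 ≡ x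
⊕-identityʳ = zipWith-identityʳ Bool.xor-identityʳ

⊕-self : (x : Card n) → x ⊕ x ≡ 𝟘
⊕-self []      = refl
⊕-self (b ∷ x) = cong₂ _∷_ (Bool.xor-same b) (⊕-self x)

⊕-cancelˡ : (x y : Card n) → x ⊕ (x ⊕ y) ≡ y
⊕-cancelˡ x y = begin
  x ⊕ (x ⊕ y) ≡⟨ ⊕-assoc x x y ⟨
  (x ⊕ x) ⊕ y ≡⟨ cong (_⊕ y) (⊕-self x) ⟩
  𝟘 ⊕ y       ≡⟨ ⊕-identityˡ y ⟩
  y           ∎
  where open ≡-Reasoning

⊕-cancelʳ : (x y : Card n) → (x ⊕ y) ⊕ y ≡ x
⊕-cancelʳ x y = trans (cong (_⊕ y) (⊕-comm x y)) (trans (⊕-assoc y x y) (trans (cong (y ⊕_) (⊕-comm x y)) (⊕-cancelˡ y x)))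

⊕-swap : (x y z : Card n) → x ⊕ (y ⊕ z) ≡ y ⊕ (x ⊕ z)
⊕-swap x y z = trans (sym (⊕-assoc x y z)) (trans (cong (_⊕ z) (⊕-comm x y)) (⊕-assoc y x z))

⊕≡𝟘⇒≡ : {x y : Card n} → x ⊕ y ≡ 𝟘 → x ≡ y
⊕≡𝟘⇒≡ {x = x} {y} e = trans (sym (⊕-cancelʳ x y)) (trans (cong (_⊕ y) e) (⊕-identityˡ y))

≡⇒⊕≡𝟘 : {x y : Card n} → x ≡ y → x ⊕ y ≡ 𝟘
≡⇒⊕≡𝟘 {x = x} refl = ⊕-self x

_≟_ : (x y : Card n) → Dec (x ≡ y)
_≟_ = ≡-dec Bool._≟_

𝟙 : {P : Set} → Dec P → ℕ
𝟙 (yes _) = 1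
𝟙 (no _)  = 0

𝟙-yes : {P : Set} (d : Dec P) → P → 𝟙 d ≡ 1
𝟙-yes (yes _) _ = refl
𝟙-yes (no ¬p) p = contradiction p ¬p

𝟙-no : {P : Set} (d : Dec P) → ¬ P → 𝟙 d ≡ 0
𝟙-no (yes p) ¬p = contradiction p ¬p
𝟙-no (no _)  _  = refl

𝟙-cong : {P Q : Set} (d : Dec P) (e : Dec Q) → (P → Q) → (Q → P) → 𝟙 d ≡ 𝟙 e
𝟙-cong (yes p) e P→Q Q→P = sym (𝟙-yes e (P→Q p))
𝟙-cong (no ¬p) e P→Q Q→P = sym (𝟙-no e (λ q → ¬p (Q→P q)))

δ : Card n → Card n → ℕ
δ y x = 𝟙 (x ≟ y)

δ-refl : (y : Card n) → δ y y ≡ 1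
δ-refl y = 𝟙-yes (y ≟ y) refl

δ-≢ : {x y : Card n} → x ≢ y → δ y x ≡ 0
δ-≢ {x = x} {y} = 𝟙-no (x ≟ y)

δ-∷ : ∀ b (x y : Card n) → δ (b ∷ y) (b ∷ x) ≡ δ y x
δ-∷ b x y = 𝟙-cong ((b ∷ x) ≟ (b ∷ y)) (x ≟ y) ∷-injectiveʳ (cong (b ∷_))

-- ∑ is opaque so that unification treats it as a constant rather than unfolding it along the dimension.
opaque
  ∑ : (Card n → ℕ) → ℕ
  ∑ {zero}  f = f []
  ∑ {suc n} f = ∑ (λ x → f (false ∷ x)) + ∑ (λ x → f (true ∷ x))

  ∑-cong : {f g : Card n → ℕ} → (∀ x → f x ≡ g x) → ∑ f ≡ ∑ g
  ∑-cong {zero}  f≗g = f≗g []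
  ∑-cong {suc n} f≗g = cong₂ _+_ (∑-cong (λ x → f≗g (false ∷ x))) (∑-cong (λ x → f≗g (true ∷ x)))

  ∑-zero : ∑ {n} (λ _ → 0) ≡ 0
  ∑-zero {zero}  = refl
  ∑-zero {suc n} = cong₂ _+_ (∑-zero {n}) (∑-zero {n})

  ∑-+ : (f g : Card n → ℕ) → ∑ (λ x → f x + g x) ≡ ∑ f + ∑ g
  ∑-+ {zero}  f g = refl
  ∑-+ {suc n} f g = trans (cong₂ _+_ (∑-+ {n} (λ x → f (false ∷ x)) (λ x → g (false ∷ x))) (∑-+ {n} (λ x → f (true ∷ x)) (λ x → g (true ∷ x))))
                           (medial (∑ (λ x → f (false ∷ x))) (∑ (λ x → g (false ∷ x))) (∑ (λ x → f (true ∷ x))) (∑ (λ x → g (true ∷ x))))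
    where
    medial : ∀ a b c d → a + b + (c + d) ≡ a + c + (b + d)
    medial = solve-∀

  ∑-*ˡ : (k : ℕ) (f : Card n → ℕ) → ∑ (λ x → k * f x) ≡ k * ∑ f
  ∑-*ˡ {zero}  k f = refl
  ∑-*ˡ {suc n} k f = trans (cong₂ _+_ (∑-*ˡ {n} k (λ x → f (false ∷ x))) (∑-*ˡ {n} k (λ x → f (true ∷ x)))) (sym (*-distribˡ-+ k _ _))

  ∑-comm : (f : Card n → Card n → ℕ) → ∑ (λ a → ∑ (λ b → f a b)) ≡ ∑ (λ b → ∑ (λ a → f a b))
  ∑-comm {zero}  f = refl
  ∑-comm {suc n} f = begin
    ∑ (λ a → f₀₀ a + f₀₁ a) + ∑ (λ a → f₁₀ a + f₁₁ a)   ≡⟨ cong₂ _+_ (∑-+ f₀₀ f₀₁) (∑-+ f₁₀ f₁₁) ⟩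
    ∑ f₀₀ + ∑ f₀₁ + (∑ f₁₀ + ∑ f₁₁)                     ≡⟨ medial (∑ f₀₀) (∑ f₀₁) (∑ f₁₀) (∑ f₁₁) ⟩
    ∑ f₀₀ + ∑ f₁₀ + (∑ f₀₁ + ∑ f₁₁)                     ≡⟨ cong₂ _+_ (cong₂ _+_ (∑-comm {n} _) (∑-comm {n} _)) (cong₂ _+_ (∑-comm {n} _) (∑-comm {n} _)) ⟩
    ∑ g₀₀ + ∑ g₁₀ + (∑ g₀₁ + ∑ g₁₁)                     ≡⟨ cong₂ _+_ (∑-+ g₀₀ g₁₀) (∑-+ g₀₁ g₁₁) ⟨
    ∑ (λ b → g₀₀ b + g₁₀ b) + ∑ (λ b → g₀₁ b + g₁₁ b)   ∎
    where
    open ≡-Reasoning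
    medial : ∀ a b c d → a + b + (c + d) ≡ a + c + (b + d)
    medial = solve-∀
    f₀₀ f₀₁ f₁₀ f₁₁ g₀₀ g₀₁ g₁₀ g₁₁ : Card n → ℕ
    f₀₀ a = ∑ λ b → f (false ∷ a) (false ∷ b)
    f₀₁ a = ∑ λ b → f (false ∷ a) (true ∷ b)
    f₁₀ a = ∑ λ b → f (true ∷ a) (false ∷ b)
    f₁₁ a = ∑ λ b → f (true ∷ a) (true ∷ b)
    g₀₀ b = ∑ λ a → f (false ∷ a) (false ∷ b)
    g₀₁ b = ∑ λ a → f (false ∷ a) (true ∷ b)
    g₁₀ b = ∑ λ a → f (true ∷ a) (false ∷ b)
    g₁₁ b = ∑ λ a → f (true ∷ a) (true ∷ b)

  ∑-translate : (v : Card n) (f : Card n → ℕ) → ∑ f ≡ ∑ (λ x → f (v ⊕ x))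
  ∑-translate []            f = refl
  ∑-translate (false ∷ v) f =
    cong₂ _+_ (∑-translate v (λ x → f (false ∷ x))) (∑-translate v (λ x → f (true ∷ x)))
  ∑-translate (true ∷ v)  f =
    trans (+-comm (∑ (λ x → f (false ∷ x))) (∑ (λ x → f (true ∷ x)))) (cong₂ _+_ (∑-translate v (λ x → f (true ∷ x))) (∑-translate v (λ x → f (false ∷ x))))

  ∑-δ : (y : Card n) (f : Card n → ℕ) → ∑ (λ x → δ y x * f x) ≡ f y
  ∑-δ []          f = trans (cong (_* f []) (δ-refl [])) (*-identityˡ (f []))
  ∑-δ {suc n} (false ∷ y) f = begin
    ∑ (λ x → δ (false ∷ y) (false ∷ x) * f (false ∷ x)) + ∑ (λ x → δ (false ∷ y) (true ∷ x) * f (true ∷ x))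
      ≡⟨ cong₂ _+_ (∑-cong (λ x → cong (_* f (false ∷ x)) (δ-∷ false x y)))
                   (trans (∑-cong (λ x → cong (_* f (true ∷ x)) (δ-≢ {x = true ∷ x} {false ∷ y} λ ()))) (∑-zero {n})) ⟩
    ∑ (λ x → δ y x * f (false ∷ x)) + 0
      ≡⟨ trans (+-identityʳ _) (∑-δ y (λ x → f (false ∷ x))) ⟩
    f (false ∷ y) ∎
    where open ≡-Reasoning
  ∑-δ {suc n} (true ∷ y)  f = begin
    ∑ (λ x → δ (true ∷ y) (false ∷ x) * f (false ∷ x)) + ∑ (λ x → δ (true ∷ y) (true ∷ x) * f (true ∷ x))
      ≡⟨ cong₂ _+_ (trans (∑-cong (λ x → cong (_* f (false ∷ x)) (δ-≢ {x = false ∷ x} {true ∷ y} λ ()))) (∑-zero {n}))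
                   (∑-cong (λ x → cong (_* f (true ∷ x)) (δ-∷ true x y))) ⟩
    0 + ∑ (λ x → δ y x * f (true ∷ x))
      ≡⟨ ∑-δ y (λ x → f (true ∷ x)) ⟩
    f (true ∷ y) ∎
    where open ≡-Reasoning

∑-*ʳ : (k : ℕ) (f : Card n → ℕ) → ∑ (λ x → f x * k) ≡ ∑ f * k
∑-*ʳ k f = trans (∑-cong (λ x → *-comm (f x) k)) (trans (∑-*ˡ k f) (*-comm k (∑ f)))

∑-δ-1 : (y : Card n) → ∑ (δ y) ≡ 1
∑-δ-1 y = trans (∑-cong (λ x → sym (*-identityʳ (δ y x)))) (∑-δ y (λ _ → 1))

mult : List (Card n) → Card n → ℕ
mult []      x = 0
mult (y ∷ L) x = δ y x + mult L x

mult-∉ : {x : Card n} (L : List (Card n)) → x ∉ L → mult L x ≡ 0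
mult-∉ []      _   = refl
mult-∉ (y ∷ L) x∉L = cong₂ _+_ (δ-≢ (λ x≡y → x∉L (here x≡y))) (mult-∉ L (λ x∈L → x∉L (there x∈L)))

mult-∈ : {x : Card n} {L : List (Card n)} → Unique L → x ∈ L → mult L x ≡ 1
mult-∈ {L = y ∷ L} (y∉L ∷ _) (here refl) =
  cong₂ _+_ (δ-refl y) (mult-∉ L (λ y∈L → All.lookup y∉L y∈L refl))
mult-∈ {L = y ∷ L} (y∉L ∷ L!) (there x∈L) =
  cong₂ _+_ (δ-≢ (λ { refl → All.lookup y∉L x∈L refl })) (mult-∈ L! x∈L)

mult≡0⊎∈ : (L : List (Card n)) (x : Card n) → mult L x ≡ 0 ⊎ x ∈ L
mult≡0⊎∈ []      x = inj₁ refl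
mult≡0⊎∈ (y ∷ L) x with x ≟ y | mult≡0⊎∈ L x
... | yes x≡y | _         = inj₂ (here x≡y)
... | no _    | inj₁ 0≡   = inj₁ 0≡
... | no _    | inj₂ x∈L  = inj₂ (there x∈L)

∑-mult : (L : List (Card n)) → ∑ (mult L) ≡ length L
∑-mult {n} []      = ∑-zero {n}
∑-mult (y ∷ L) = trans (∑-+ (δ y) (mult L)) (cong₂ _+_ (∑-δ-1 y) (∑-mult L))

mult-idem : {L : List (Card n)} → Unique L → (x : Card n) → mult L x * mult L x ≡ mult L x
mult-idem {L = L} L! x with mult≡0⊎∈ L x
... | inj₁ 0≡ rewrite 0≡ = refl
... | inj₂ x∈L rewrite mult-∈ L! x∈L = refl

-- Counting quadruples

-- quadForm (mult X) (mult X) (mult X) (mult X) counts the ordered quadruples of X with sum 𝟘.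
quadForm : (w₁ w₂ w₃ w₄ : Card n → ℕ) → ℕ
quadForm w₁ w₂ w₃ w₄ = ∑ λ a → ∑ λ b → ∑ λ c → w₁ a * w₂ b * w₃ c * w₄ (a ⊕ (b ⊕ c))

∑³-cong : {f g : Card n → Card n → Card n → ℕ} → (∀ a b c → f a b c ≡ g a b c) →
          (∑ λ a → ∑ λ b → ∑ λ c → f a b c) ≡ (∑ λ a → ∑ λ b → ∑ λ c → g a b c)
∑³-cong f≗g = ∑-cong (λ a → ∑-cong (λ b → ∑-cong (λ c → f≗g a b c)))

∑³-+ : (f g : Card n → Card n → Card n → ℕ) →
       (∑ λ a → ∑ λ b → ∑ λ c → f a b c + g a b c) ≡ (∑ λ a → ∑ λ b → ∑ λ c → f a b c) + (∑ λ a → ∑ λ b → ∑ λ c → g a b c)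
∑³-+ f g = trans (∑-cong (λ a → trans (∑-cong (λ b → ∑-+ (f a b) (g a b))) (∑-+ _ _))) (∑-+ _ _)

quadForm-cong₄ : (u v w : Card n → ℕ) {p q : Card n → ℕ} → (∀ d → p d ≡ q d) → quadForm u v w p ≡ quadForm u v w q
quadForm-cong₄ u v w p≗q = ∑³-cong (λ a b c → cong (u a * v b * w c *_) (p≗q _))

quadForm-+₄ : (u v w p q : Card n → ℕ) → quadForm u v w (λ d → p d + q d) ≡ quadForm u v w p + quadForm u v w q
quadForm-+₄ u v w p q = trans (∑³-cong (λ a b c → *-distribˡ-+ (u a * v b * w c) (p _) (q _))) (∑³-+ _ _)

quadForm-zero₄ : (u v w : Card n → ℕ) → quadForm u v w (λ _ → 0) ≡ 0
quadForm-zero₄ {n} u v w = trans (∑³-cong (λ a b c → *-zeroʳ (u a * v b * w c)))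
  (trans (∑-cong (λ a → trans (∑-cong (λ b → ∑-zero {n})) (∑-zero {n}))) (∑-zero {n}))

quadForm-swap₁₂ : (u v w x : Card n → ℕ) → quadForm u v w x ≡ quadForm v u w x
quadForm-swap₁₂ u v w x = trans (∑-comm (λ a b → ∑ λ c → u a * v b * w c * x (a ⊕ (b ⊕ c))))
  (∑³-cong (λ b a c → cong₂ _*_ (cong (_* w c) (*-comm (u a) (v b))) (cong x (⊕-swap a b c))))

quadForm-swap₂₃ : (u v w x : Card n → ℕ) → quadForm u v w x ≡ quadForm u w v x
quadForm-swap₂₃ u v w x = ∑-cong (λ a → trans (∑-comm (λ b c → u a * v b * w c * x (a ⊕ (b ⊕ c))))
  (∑-cong (λ c → ∑-cong (λ b → cong₂ _*_ (reorder (u a) (v b) (w c)) (cong (λ t → x (a ⊕ t)) (⊕-comm b c))))))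
  where
  reorder : ∀ p q r → p * q * r ≡ p * r * q
  reorder = solve-∀

-- Substituting c ↦ a ⊕ b ⊕ c exchanges the third card with the sum-completing fourth one.
quadForm-swap₃₄ : (u v w x : Card n → ℕ) → quadForm u v w x ≡ quadForm u v x w
quadForm-swap₃₄ u v w x = ∑-cong (λ a → ∑-cong (λ b →
  trans (∑-translate (a ⊕ b) (λ c → u a * v b * w c * x (a ⊕ (b ⊕ c))))
        (∑-cong (λ c → trans (cong₂ (λ s t → u a * v b * w s * x t) (⊕-assoc a b c) (completes a b c))
                             (reorder (u a) (v b) (w _) (x c))))))
  where
  reorder : ∀ p q r s → p * q * r * s ≡ p * q * s * r
  reorder = solve-∀
  completes : (a b c : Card n) → a ⊕ (b ⊕ ((a ⊕ b) ⊕ c)) ≡ c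
  completes a b c = trans (sym (⊕-assoc a b _)) (⊕-cancelˡ (a ⊕ b) c)

quadForm-swap₂₄ : (u v w x : Card n → ℕ) → quadForm u v w x ≡ quadForm u x w v
quadForm-swap₂₄ u v w x = trans (quadForm-swap₂₃ u v w x) (trans (quadForm-swap₃₄ u w v x) (quadForm-swap₂₃ u w x v))

quadForm-swap₁₄ : (u v w x : Card n → ℕ) → quadForm u v w x ≡ quadForm x v w u
quadForm-swap₁₄ u v w x = trans (quadForm-swap₁₂ u v w x) (trans (quadForm-swap₂₄ v u w x) (quadForm-swap₁₂ v x w u))

_⋆_ : (f g : Card n → ℕ) → Card n → ℕ
(f ⋆ g) u = ∑ λ c → f c * g (u ⊕ c)

⋆-comm : (f g : Card n → ℕ) (u : Card n) → (f ⋆ g) u ≡ (g ⋆ f) u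
⋆-comm f g u = trans (∑-translate u (λ c → f c * g (u ⊕ c)))
  (∑-cong (λ c → trans (cong (λ t → f (u ⊕ c) * g t) (⊕-cancelˡ u c)) (*-comm (f (u ⊕ c)) (g c))))

δ⋆ : (z : Card n) (g : Card n → ℕ) (u : Card n) → (δ z ⋆ g) u ≡ g (u ⊕ z)
δ⋆ z g u = ∑-δ z (λ c → g (u ⊕ c))

⋆-+ʳ : (f p q : Card n → ℕ) (u : Card n) → (f ⋆ (λ d → p d + q d)) u ≡ (f ⋆ p) u + (f ⋆ q) u
⋆-+ʳ f p q u = trans (∑-cong (λ c → *-distribˡ-+ (f c) (p _) (q _))) (∑-+ _ _)

⋆-𝟘 : (f g : Card n → ℕ) → (f ⋆ g) 𝟘 ≡ ∑ (λ c → f c * g c)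
⋆-𝟘 f g = ∑-cong (λ c → cong (λ t → f c * g t) (⊕-identityˡ c))

quadForm-δδ : (y z : Card n) (f g : Card n → ℕ) → quadForm (δ y) (δ z) f g ≡ (f ⋆ g) (y ⊕ z)
quadForm-δδ y z f g = begin
  (∑ λ a → ∑ λ b → ∑ λ c → δ y a * δ z b * f c * g (a ⊕ (b ⊕ c)))
    ≡⟨ ∑-cong (λ a → trans (∑-cong (λ b → trans (∑-cong (λ c → reorder (δ y a) (δ z b) (f c) (g _)))
                                                 (∑-*ˡ (δ y a) _)))
                           (∑-*ˡ (δ y a) _)) ⟩
  (∑ λ a → δ y a * ∑ λ b → ∑ λ c → δ z b * (f c * g (a ⊕ (b ⊕ c))))
    ≡⟨ ∑-δ y _ ⟩
  (∑ λ b → ∑ λ c → δ z b * (f c * g (y ⊕ (b ⊕ c))))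
    ≡⟨ ∑-cong (λ b → ∑-*ˡ (δ z b) _) ⟩
  (∑ λ b → δ z b * ∑ λ c → f c * g (y ⊕ (b ⊕ c)))
    ≡⟨ ∑-δ z _ ⟩
  (∑ λ c → f c * g (y ⊕ (z ⊕ c)))
    ≡⟨ ∑-cong (λ c → cong (λ t → f c * g t) (sym (⊕-assoc y z c))) ⟩
  (f ⋆ g) (y ⊕ z) ∎
  where
  open ≡-Reasoning
  reorder : ∀ p q r s → p * q * r * s ≡ p * (q * (r * s))
  reorder = solve-∀

countSubsetsWithSum : ℕ → Card n → List (Card n) → ℕ
countSubsetsWithSum zero    v _       = δ 𝟘 v
countSubsetsWithSum (suc k) v []      = 0
countSubsetsWithSum (suc k) v (x ∷ L) = countSubsetsWithSum k (v ⊕ x) L + countSubsetsWithSum (suc k) v L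

length-filter-singleton : {A : Set} {P : A → Set} (P? : Decidable P) (x : A) → length (filter P? (x ∷ [])) ≡ 𝟙 (P? x)
length-filter-singleton P? x with P? x
... | yes _ = refl
... | no _  = refl

length-filter-map : {A B : Set} {P : B → Set} (P? : Decidable P) (f : A → B) (xs : List A) →
                    length (filter P? (map f xs)) ≡ length (filter (λ x → P? (f x)) xs)
length-filter-map P? f []       = refl
length-filter-map P? f (x ∷ xs) with P? (f x)
... | yes _ = cong suc (length-filter-map P? f xs)
... | no _  = length-filter-map P? f xs

length-filter-subsets : ∀ k (v : Card n) L →
  length (filter (λ T → sumCards T ≟ v) (subsets k L)) ≡ countSubsetsWithSum k v L
length-filter-subsets zero    v L       = trans (length-filter-singleton (λ T → sumCards T ≟ v) [])
                                                (𝟙-cong (𝟘 ≟ v) (v ≟ 𝟘) sym sym)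
length-filter-subsets (suc k) v []      = refl
length-filter-subsets (suc k) v (x ∷ L) = begin
  length (filter P? (map (x ∷_) (subsets k L) ++ subsets (suc k) L))
    ≡⟨ cong length (filter-++ P? (map (x ∷_) (subsets k L)) (subsets (suc k) L)) ⟩
  length (filter P? (map (x ∷_) (subsets k L)) ++ filter P? (subsets (suc k) L))
    ≡⟨ length-++ (filter P? (map (x ∷_) (subsets k L))) ⟩
  length (filter P? (map (x ∷_) (subsets k L))) + length (filter P? (subsets (suc k) L))
    ≡⟨ cong₂ _+_ (length-filter-map P? (x ∷_) (subsets k L)) (length-filter-subsets (suc k) v L) ⟩
  length (filter (λ T → P? (x ∷ T)) (subsets k L)) + countSubsetsWithSum (suc k) v L
    ≡⟨ cong (λ t → length t + countSubsetsWithSum (suc k) v L)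
            (filter-≐ (λ T → P? (x ∷ T)) (λ T → sumCards T ≟ (v ⊕ x)) ((λ {T} → move {T}) , (λ {T} → unmove {T})) (subsets k L)) ⟩
  length (filter (λ T → sumCards T ≟ (v ⊕ x)) (subsets k L)) + countSubsetsWithSum (suc k) v L
    ≡⟨ cong (_+ countSubsetsWithSum (suc k) v L) (length-filter-subsets k (v ⊕ x) L) ⟩
  countSubsetsWithSum (suc k) v (x ∷ L) ∎
  where
  open ≡-Reasoning
  P? = λ T → sumCards T ≟ v
  move : ∀ {T} → x ⊕ sumCards T ≡ v → sumCards T ≡ v ⊕ x
  move {T} e = trans (sym (⊕-cancelˡ x (sumCards T))) (trans (cong (x ⊕_) e) (⊕-comm x v))
  unmove : ∀ {T} → sumCards T ≡ v ⊕ x → x ⊕ sumCards T ≡ v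
  unmove {T} e = trans (cong (x ⊕_) (trans e (⊕-comm v x))) (⊕-cancelˡ x v)

numQuads≡countSubsetsWithSum : (X : List (Card n)) → numQuads X ≡ countSubsetsWithSum 4 𝟘 X
numQuads≡countSubsetsWithSum = length-filter-subsets 4 𝟘

countSubsetsWithSum-1 : (v : Card n) (L : List (Card n)) → countSubsetsWithSum 1 v L ≡ mult L v
countSubsetsWithSum-1 v []      = refl
countSubsetsWithSum-1 v (x ∷ L) =
  cong₂ _+_ (𝟙-cong ((v ⊕ x) ≟ 𝟘) (v ≟ x) ⊕≡𝟘⇒≡ ≡⇒⊕≡𝟘) (countSubsetsWithSum-1 v L)

-- For u ≢ 𝟘 no ordered pair (c, c) sums to u, so ordered pairs are twice the unordered ones.
mult⋆mult : (u : Card n) → u ≢ 𝟘 → (V : List (Card n)) → (mult V ⋆ mult V) u ≡ 2 * countSubsetsWithSum 2 u V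
mult⋆mult {n} u u≢𝟘 []      = ∑-zero {n}
mult⋆mult u u≢𝟘 (z ∷ V) = begin
  (W ⋆ W) u                                    ≡⟨ ⋆-+ʳ W (δ z) (mult V) u ⟩
  (W ⋆ δ z) u + (W ⋆ mult V) u                 ≡⟨ cong₂ _+_ (⋆-comm W (δ z) u) (⋆-comm W (mult V) u) ⟩
  (δ z ⋆ W) u + (mult V ⋆ W) u                 ≡⟨ cong₂ _+_ (δ⋆ z W u) (⋆-+ʳ (mult V) (δ z) (mult V) u) ⟩
  W (u ⊕ z) + ((mult V ⋆ δ z) u + (mult V ⋆ mult V) u)
    ≡⟨ cong₂ (λ s t → s + mult V (u ⊕ z) + (t + (mult V ⋆ mult V) u)) (δ-≢ u⊕z≢z) (⋆-comm (mult V) (δ z) u) ⟩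
  mult V (u ⊕ z) + ((δ z ⋆ mult V) u + (mult V ⋆ mult V) u)
    ≡⟨ cong₂ (λ s t → mult V (u ⊕ z) + (s + t)) (δ⋆ z (mult V) u) (mult⋆mult u u≢𝟘 V) ⟩
  mult V (u ⊕ z) + (mult V (u ⊕ z) + 2 * countSubsetsWithSum 2 u V)
    ≡⟨ twice (mult V (u ⊕ z)) (countSubsetsWithSum 2 u V) ⟩
  2 * (mult V (u ⊕ z) + countSubsetsWithSum 2 u V)
    ≡⟨ cong (λ t → 2 * (t + countSubsetsWithSum 2 u V)) (sym (countSubsetsWithSum-1 (u ⊕ z) V)) ⟩
  2 * countSubsetsWithSum 2 u (z ∷ V) ∎
  where
  open ≡-Reasoning
  W = mult (z ∷ V)
  u⊕z≢z : u ⊕ z ≢ z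
  u⊕z≢z e = u≢𝟘 (trans (sym (⊕-cancelʳ u z)) (trans (cong (_⊕ z) e) (⊕-self z)))
  twice : ∀ a b → a + (a + 2 * b) ≡ 2 * (a + b)
  twice = solve-∀

quadForm-δ₁δ₄ : (y z : Card n) (f g : Card n → ℕ) → quadForm (δ y) f g (δ z) ≡ (g ⋆ f) (y ⊕ z)
quadForm-δ₁δ₄ y z f g = trans (quadForm-swap₂₄ (δ y) f g (δ z)) (quadForm-δδ y z g f)

-- For y ∉ V no ordered triple with a repeated card sums to y.
quadForm-δ-mult³ : (y : Card n) (V : List (Card n)) → y ∉ V →
                   quadForm (δ y) (mult V) (mult V) (mult V) ≡ 6 * countSubsetsWithSum 3 y V
quadForm-δ-mult³ y []      _   = quadForm-zero₄ (δ y) (mult []) (mult [])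
quadForm-δ-mult³ {n} y (z ∷ V) y∉ = begin
  quadForm D W W W
    ≡⟨ quadForm-+₄ D W W (δ z) V′ ⟩
  quadForm D W W (δ z) + quadForm D W W V′
    ≡⟨ cong (quadForm D W W (δ z) +_) (trans (quadForm-swap₂₄ D W W V′) (quadForm-+₄ D V′ W (δ z) V′)) ⟩
  quadForm D W W (δ z) + (quadForm D V′ W (δ z) + quadForm D V′ W V′)
    ≡⟨ cong (λ t → quadForm D W W (δ z) + (quadForm D V′ W (δ z) + t))
            (trans (quadForm-swap₃₄ D V′ W V′) (quadForm-+₄ D V′ V′ (δ z) V′)) ⟩
  quadForm D W W (δ z) + (quadForm D V′ W (δ z) + (quadForm D V′ V′ (δ z) + quadForm D V′ V′ V′))
    ≡⟨ cong₂ (λ a b → a + (b + (quadForm D V′ V′ (δ z) + quadForm D V′ V′ V′)))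
             (trans (quadForm-δ₁δ₄ y z W W) W⋆W) (trans (quadForm-δ₁δ₄ y z V′ W) W⋆V′) ⟩
  (V′ ⋆ V′) u + ((V′ ⋆ V′) u + (quadForm D V′ V′ (δ z) + quadForm D V′ V′ V′))
    ≡⟨ cong₂ (λ a b → (V′ ⋆ V′) u + ((V′ ⋆ V′) u + (a + b)))
             (quadForm-δ₁δ₄ y z V′ V′) (quadForm-δ-mult³ y V (λ y∈V → y∉ (there y∈V))) ⟩
  (V′ ⋆ V′) u + ((V′ ⋆ V′) u + ((V′ ⋆ V′) u + 6 * countSubsetsWithSum 3 y V))
    ≡⟨ cong (λ a → a + (a + (a + 6 * countSubsetsWithSum 3 y V))) (mult⋆mult u u≢𝟘 V) ⟩
  2 * c₂ + (2 * c₂ + (2 * c₂ + 6 * countSubsetsWithSum 3 y V))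
    ≡⟨ thrice c₂ (countSubsetsWithSum 3 y V) ⟩
  6 * countSubsetsWithSum 3 y (z ∷ V) ∎
  where
  open ≡-Reasoning
  D  = δ y
  W  = mult (z ∷ V)
  V′ = mult V
  u  = y ⊕ z
  c₂ = countSubsetsWithSum 2 u V
  u≢𝟘 : u ≢ 𝟘
  u≢𝟘 e = y∉ (here (⊕≡𝟘⇒≡ e))
  a⋆δz : (a : Card n → ℕ) → (a ⋆ δ z) u ≡ a y
  a⋆δz a = trans (⋆-comm a (δ z) u) (trans (δ⋆ z a u) (cong a (⊕-cancelʳ y z)))
  V′y≡0 : V′ y ≡ 0
  V′y≡0 = mult-∉ V (λ y∈V → y∉ (there y∈V))
  W⋆V′ : (W ⋆ V′) u ≡ (V′ ⋆ V′) u
  W⋆V′ = trans (⋆-comm W V′ u) (trans (⋆-+ʳ V′ (δ z) V′ u) (cong (_+ (V′ ⋆ V′) u) (trans (a⋆δz V′) V′y≡0)))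
  W⋆W : (W ⋆ W) u ≡ (V′ ⋆ V′) u
  W⋆W = begin
    (W ⋆ W) u                    ≡⟨ ⋆-+ʳ W (δ z) V′ u ⟩
    (W ⋆ δ z) u + (W ⋆ V′) u     ≡⟨ cong (_+ (W ⋆ V′) u) (a⋆δz W) ⟩
    W y + (W ⋆ V′) u             ≡⟨ cong₂ _+_ (cong₂ _+_ (δ-≢ (λ y≡z → y∉ (here y≡z))) V′y≡0) W⋆V′ ⟩
    (V′ ⋆ V′) u                  ∎
  thrice : ∀ a b → 2 * a + (2 * a + (2 * a + 6 * b)) ≡ 6 * (a + b)
  thrice = solve-∀

quadForm-+₁ : (p q v w x : Card n → ℕ) → quadForm (λ d → p d + q d) v w x ≡ quadForm p v w x + quadForm q v w x
quadForm-+₁ p q v w x = begin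
  quadForm (λ d → p d + q d) v w x          ≡⟨ quadForm-swap₁₄ (λ d → p d + q d) v w x ⟩
  quadForm x v w (λ d → p d + q d)          ≡⟨ quadForm-+₄ x v w p q ⟩
  quadForm x v w p + quadForm x v w q       ≡⟨ cong₂ _+_ (quadForm-swap₁₄ x v w p) (quadForm-swap₁₄ x v w q) ⟩
  quadForm p v w x + quadForm q v w x       ∎
  where open ≡-Reasoning

quadForm-+₂ : (u p q w x : Card n → ℕ) → quadForm u (λ d → p d + q d) w x ≡ quadForm u p w x + quadForm u q w x
quadForm-+₂ u p q w x = begin
  quadForm u (λ d → p d + q d) w x          ≡⟨ quadForm-swap₂₄ u (λ d → p d + q d) w x ⟩
  quadForm u x w (λ d → p d + q d)          ≡⟨ quadForm-+₄ u x w p q ⟩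
  quadForm u x w p + quadForm u x w q       ≡⟨ cong₂ _+_ (quadForm-swap₂₄ u x w p) (quadForm-swap₂₄ u x w q) ⟩
  quadForm u p w x + quadForm u q w x       ∎
  where open ≡-Reasoning

quadForm-+₃ : (u v p q x : Card n → ℕ) → quadForm u v (λ d → p d + q d) x ≡ quadForm u v p x + quadForm u v q x
quadForm-+₃ u v p q x = begin
  quadForm u v (λ d → p d + q d) x          ≡⟨ quadForm-swap₃₄ u v (λ d → p d + q d) x ⟩
  quadForm u v x (λ d → p d + q d)          ≡⟨ quadForm-+₄ u v x p q ⟩
  quadForm u v x p + quadForm u v x q       ≡⟨ cong₂ _+_ (quadForm-swap₃₄ u v x p) (quadForm-swap₃₄ u v x q) ⟩
  quadForm u v p x + quadForm u v q x       ∎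
  where open ≡-Reasoning

-- The symmetric form analogue of x⁴ = p (x³ + x² q + x q² + q³) + q⁴ for x = p + q.
quadForm-binomial : (p q : Card n → ℕ) → let x = λ d → p d + q d in
  quadForm x x x x ≡ quadForm p x x x + (quadForm p q x x + (quadForm p q q x + (quadForm p q q q + quadForm q q q q)))
quadForm-binomial p q = begin
  quadForm x x x x
    ≡⟨ quadForm-+₁ p q x x x ⟩
  quadForm p x x x + quadForm q x x x
    ≡⟨ cong (quadForm p x x x +_) (trans (quadForm-+₂ q p q x x) (cong (_+ quadForm q q x x) (quadForm-swap₁₂ q p x x))) ⟩
  quadForm p x x x + (quadForm p q x x + quadForm q q x x)
    ≡⟨ cong (λ t → quadForm p x x x + (quadForm p q x x + t))
            (trans (quadForm-+₃ q q p q x) (cong (_+ quadForm q q q x) (trans (quadForm-swap₂₃ q q p x) (quadForm-swap₁₂ q p q x)))) ⟩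
  quadForm p x x x + (quadForm p q x x + (quadForm p q q x + quadForm q q q x))
    ≡⟨ cong (λ t → quadForm p x x x + (quadForm p q x x + (quadForm p q q x + t)))
            (trans (quadForm-+₄ q q q p q) (cong (_+ quadForm q q q q) (quadForm-swap₁₄ q q q p))) ⟩
  quadForm p x x x + (quadForm p q x x + (quadForm p q q x + (quadForm p q q q + quadForm q q q q))) ∎
  where
  open ≡-Reasoning
  x = λ d → p d + q d

mult⋆mult-𝟘 : {L : List (Card n)} → Unique L → (mult L ⋆ mult L) 𝟘 ≡ length L
mult⋆mult-𝟘 {L = L} L! = trans (⋆-𝟘 (mult L) (mult L)) (trans (∑-cong (mult-idem L!)) (∑-mult L))

orderedQuads : List (Card n) → ℕ
orderedQuads X = quadForm (mult X) (mult X) (mult X) (mult X)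

-- The new ordered quadruples contain y once (24 per triple of Y summing to y), twice (the 6 arrangements of
-- y, y, c, c for each c ∈ Y) or four times.
orderedQuads-∷ : {y : Card n} {Y : List (Card n)} → Unique (y ∷ Y) →
  orderedQuads (y ∷ Y) ≡ orderedQuads Y + (6 * length Y + 1) + 24 * countSubsetsWithSum 3 y Y
orderedQuads-∷ {n} {y} {Y} yY!@(y≢Y ∷ Y!) = begin
  orderedQuads (y ∷ Y)
    ≡⟨ quadForm-binomial D W ⟩
  quadForm D X X X + (quadForm D W X X + (quadForm D W W X + (quadForm D W W W + orderedQuads Y)))
    ≡⟨ cong₂ _+_ DXXX (cong₂ _+_ DWXX (cong₂ _+_ DWWX (cong (_+ orderedQuads Y) DWWW))) ⟩
  suc s + (s + (s + 6 * Z)) + (s + (s + 6 * Z) + (s + 6 * Z + (6 * Z + orderedQuads Y)))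
    ≡⟨ collect s Z (orderedQuads Y) ⟩
  orderedQuads Y + (6 * s + 1) + 24 * Z ∎
  where
  open ≡-Reasoning
  D = δ y
  W = mult Y
  X = mult (y ∷ Y)
  s = length Y
  Z = countSubsetsWithSum 3 y Y
  y∉Y : y ∉ Y
  y∉Y y∈Y = All.lookup y≢Y y∈Y refl
  at-y⊕y : (f g : Card n → ℕ) → (f ⋆ g) (y ⊕ y) ≡ ∑ (λ c → f c * g c)
  at-y⊕y f g = trans (cong (f ⋆ g) (⊕-self y)) (⋆-𝟘 f g)
  DWWD : quadForm D W W D ≡ s
  DWWD = trans (quadForm-δ₁δ₄ y y W W) (trans (cong (W ⋆ W) (⊕-self y)) (mult⋆mult-𝟘 Y!))
  DXWD : quadForm D W X D ≡ s
  DXWD = begin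
    quadForm D W X D                                   ≡⟨ quadForm-δ₁δ₄ y y W X ⟩
    (X ⋆ W) (y ⊕ y)                                    ≡⟨ at-y⊕y X W ⟩
    ∑ (λ c → (δ y c + W c) * W c)                      ≡⟨ ∑-cong (λ c → *-distribʳ-+ (W c) (δ y c) (W c)) ⟩
    ∑ (λ c → δ y c * W c + W c * W c)                  ≡⟨ ∑-+ (λ c → δ y c * W c) (λ c → W c * W c) ⟩
    ∑ (λ c → δ y c * W c) + ∑ (λ c → W c * W c)        ≡⟨ cong₂ _+_ (trans (∑-δ y W) (mult-∉ Y y∉Y)) (sym (at-y⊕y W W)) ⟩
    (W ⋆ W) (y ⊕ y)                                    ≡⟨ trans (cong (W ⋆ W) (⊕-self y)) (mult⋆mult-𝟘 Y!) ⟩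
    s                                                  ∎
  DXXD : quadForm D X X D ≡ suc s
  DXXD = trans (quadForm-δ₁δ₄ y y X X) (trans (cong (X ⋆ X) (⊕-self y)) (mult⋆mult-𝟘 yY!))
  DWWW : quadForm D W W W ≡ 6 * Z
  DWWW = quadForm-δ-mult³ y Y y∉Y
  DWWX : quadForm D W W X ≡ s + 6 * Z
  DWWX = trans (quadForm-+₄ D W W D W) (cong₂ _+_ DWWD DWWW)
  DWXX : quadForm D W X X ≡ s + (s + 6 * Z)
  DWXX = trans (quadForm-+₄ D W X D W) (cong₂ _+_ DXWD (trans (quadForm-swap₃₄ D W X W) DWWX))
  DXXX : quadForm D X X X ≡ suc s + (s + (s + 6 * Z))
  DXXX = trans (quadForm-+₄ D X X D W) (cong₂ _+_ DXXD (trans (quadForm-swap₂₄ D X X W) DWXX))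
  collect : ∀ s Z N → suc s + (s + (s + 6 * Z)) + (s + (s + 6 * Z) + (s + 6 * Z + (6 * Z + N))) ≡ N + (6 * s + 1) + 24 * Z
  collect = solve-∀

-- Besides the 24 orderings of each quad, the ordered quadruples with sum 𝟘 are those of the shapes
-- (a,a,b,b), (a,b,a,b), (a,b,b,a): 3ℓ² − 2ℓ of them.
orderedQuads-count : (X : List (Card n)) → Unique X →
  orderedQuads X + 2 * length X ≡ 24 * countSubsetsWithSum 4 𝟘 X + 3 * (length X * length X)
orderedQuads-count []      _          = cong (_+ 0) (quadForm-zero₄ (mult []) (mult []) (mult []))
orderedQuads-count (y ∷ Y) yY!@(_ ∷ Y!) = begin
  orderedQuads (y ∷ Y) + 2 * suc s
    ≡⟨ cong (_+ 2 * suc s) (orderedQuads-∷ yY!) ⟩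
  orderedQuads Y + (6 * s + 1) + 24 * Z + 2 * suc s
    ≡⟨ regroup (orderedQuads Y) s Z ⟩
  orderedQuads Y + 2 * s + (24 * Z + 6 * s + 3)
    ≡⟨ cong (_+ (24 * Z + 6 * s + 3)) (orderedQuads-count Y Y!) ⟩
  24 * Q + 3 * (s * s) + (24 * Z + 6 * s + 3)
    ≡⟨ collect s Z Q ⟩
  24 * (Z + Q) + 3 * (suc s * suc s)
    ≡⟨ cong (λ v → 24 * (countSubsetsWithSum 3 v Y + Q) + 3 * (suc s * suc s)) (⊕-identityˡ y) ⟨
  24 * countSubsetsWithSum 4 𝟘 (y ∷ Y) + 3 * (suc s * suc s) ∎
  where
  open ≡-Reasoning
  s = length Y
  Z = countSubsetsWithSum 3 y Y
  Q = countSubsetsWithSum 4 𝟘 Y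
  regroup : ∀ N s Z → N + (6 * s + 1) + 24 * Z + 2 * suc s ≡ N + 2 * s + (24 * Z + 6 * s + 3)
  regroup = solve-∀
  collect : ∀ s Z Q → 24 * Q + 3 * (s * s) + (24 * Z + 6 * s + 3) ≡ 24 * (Z + Q) + 3 * (suc s * suc s)
  collect = solve-∀

-- Complements in closed sets

Closed : List (Card n) → Set
Closed T = ∀ {a b c} → a ∈ T → b ∈ T → c ∈ T → a ⊕ (b ⊕ c) ∈ T

SupportedIn : (Card n → ℕ) → List (Card n) → Set
SupportedIn w T = ∀ a → w a ≡ 0 ⊎ a ∈ T

quadForm-closed : {T : List (Card n)} → Unique T → Closed T → (u v w : Card n → ℕ) →
  SupportedIn u T → SupportedIn v T → SupportedIn w T → quadForm u v w (mult T) ≡ ∑ u * ∑ v * ∑ w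
quadForm-closed {T = T} T! T-closed u v w u⊆T v⊆T w⊆T = trans (∑³-cong pointwise) factorise
  where
  pointwise : ∀ a b c → u a * v b * w c * mult T (a ⊕ (b ⊕ c)) ≡ u a * v b * w c
  pointwise a b c with u⊆T a | v⊆T b | w⊆T c
  ... | inj₁ ua≡0 | _         | _         rewrite ua≡0 = refl
  ... | inj₂ _    | inj₁ vb≡0 | _         rewrite vb≡0 | *-zeroʳ (u a) = refl
  ... | inj₂ _    | inj₂ _    | inj₁ wc≡0 rewrite wc≡0 | *-zeroʳ (u a * v b) = refl
  ... | inj₂ a∈T  | inj₂ b∈T  | inj₂ c∈T  rewrite mult-∈ T! (T-closed a∈T b∈T c∈T) = *-identityʳ _
  factorise : (∑ λ a → ∑ λ b → ∑ λ c → u a * v b * w c) ≡ ∑ u * ∑ v * ∑ w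
  factorise = begin
    (∑ λ a → ∑ λ b → ∑ λ c → u a * v b * w c) ≡⟨ ∑-cong (λ a → ∑-cong (λ b → ∑-*ˡ (u a * v b) w)) ⟩
    (∑ λ a → ∑ λ b → u a * v b * ∑ w)         ≡⟨ ∑-cong (λ a → ∑-*ʳ (∑ w) (λ b → u a * v b)) ⟩
    (∑ λ a → (∑ λ b → u a * v b) * ∑ w)       ≡⟨ ∑-*ʳ (∑ w) (λ a → ∑ λ b → u a * v b) ⟩
    (∑ λ a → ∑ λ b → u a * v b) * ∑ w         ≡⟨ cong (_* ∑ w) (∑-cong (λ a → ∑-*ˡ (u a) v)) ⟩
    (∑ λ a → u a * ∑ v) * ∑ w                 ≡⟨ cong (_* ∑ w) (∑-*ʳ (∑ v) u) ⟩
    ∑ u * ∑ v * ∑ w                           ∎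
    where open ≡-Reasoning

record ClosedPartition (T S C : List (Card n)) : Set where
  field
    T-unique   : Unique T
    T-closed   : Closed T
    S-unique   : Unique S
    C-unique   : Unique C
    mult-split : ∀ x → mult T x ≡ mult S x + mult C x

module _ {T S C : List (Card n)} (P : ClosedPartition T S C) where
  open ClosedPartition P

  length-partition : length T ≡ length S + length C
  length-partition = begin
    length T                        ≡⟨ ∑-mult T ⟨
    ∑ (mult T)                      ≡⟨ ∑-cong mult-split ⟩
    ∑ (λ x → mult S x + mult C x)   ≡⟨ ∑-+ (mult S) (mult C) ⟩
    ∑ (mult S) + ∑ (mult C)         ≡⟨ cong₂ _+_ (∑-mult S) (∑-mult C) ⟩
    length S + length C             ∎
    where open ≡-Reasoning

  -- For u, v, w ∈ {mult S, mult C}, closedness gives quadForm u v w (mult S) + quadForm u v w (mult C) = ∑u ∑v ∑w;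
  -- four of these identities telescope.
  orderedQuads-partition : let ℓ = length S; m = length C in
    orderedQuads S + (m * ℓ * ℓ + m * m * m) ≡ ℓ * ℓ * ℓ + m * m * ℓ + orderedQuads C
  orderedQuads-partition = telescope E₁ E₂ E₃ E₄
    where
    sS = mult S
    sC = mult C
    ℓ = length S
    m = length C
    ⊆T : (L : List (Card n)) → (∀ x → mult L x ≤ mult T x) → SupportedIn (mult L) T
    ⊆T L L≤T x with mult≡0⊎∈ T x
    ... | inj₁ Tx≡0 = inj₁ (n≤0⇒n≡0 (subst (mult L x ≤_) Tx≡0 (L≤T x)))
    ... | inj₂ x∈T  = inj₂ x∈T
    S⊆T : SupportedIn sS T
    S⊆T = ⊆T S (λ x → subst (sS x ≤_) (sym (mult-split x)) (m≤m+n (sS x) (sC x)))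
    C⊆T : SupportedIn sC T
    C⊆T = ⊆T C (λ x → subst (sC x ≤_) (sym (mult-split x)) (m≤n+m (sC x) (sS x)))
    block : (u v w : Card n → ℕ) → SupportedIn u T → SupportedIn v T → SupportedIn w T →
            quadForm u v w sS + quadForm u v w sC ≡ ∑ u * ∑ v * ∑ w
    block u v w u⊆T v⊆T w⊆T = begin
      quadForm u v w sS + quadForm u v w sC     ≡⟨ quadForm-+₄ u v w sS sC ⟨
      quadForm u v w (λ x → sS x + sC x)       ≡⟨ quadForm-cong₄ u v w mult-split ⟨
      quadForm u v w (mult T)                  ≡⟨ quadForm-closed T-unique T-closed u v w u⊆T v⊆T w⊆T ⟩
      ∑ u * ∑ v * ∑ w                          ∎
      where open ≡-Reasoning
    E₁ : orderedQuads S + quadForm sC sS sS sS ≡ ℓ * ℓ * ℓ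
    E₁ = trans (cong (orderedQuads S +_) (quadForm-swap₁₄ sC sS sS sS))
               (trans (block sS sS sS S⊆T S⊆T S⊆T) (cong (λ p → p * p * p) (∑-mult S)))
    E₂ : quadForm sC sS sS sS + quadForm sC sC sS sS ≡ m * ℓ * ℓ
    E₂ = trans (cong (quadForm sC sS sS sS +_) (quadForm-swap₂₄ sC sC sS sS))
               (trans (block sC sS sS C⊆T S⊆T S⊆T) (cong₂ (λ p q → p * q * q) (∑-mult C) (∑-mult S)))
    E₃ : quadForm sC sC sS sS + quadForm sC sC sC sS ≡ m * m * ℓ
    E₃ = trans (cong (quadForm sC sC sS sS +_) (quadForm-swap₃₄ sC sC sC sS))
               (trans (block sC sC sS C⊆T C⊆T S⊆T) (cong₂ (λ p q → p * p * q) (∑-mult C) (∑-mult S)))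
    E₄ : quadForm sC sC sC sS + orderedQuads C ≡ m * m * m
    E₄ = trans (block sC sC sC C⊆T C⊆T C⊆T) (cong (λ p → p * p * p) (∑-mult C))
    telescope : ∀ {a b c d e} → a + b ≡ ℓ * ℓ * ℓ → b + c ≡ m * ℓ * ℓ → c + d ≡ m * m * ℓ → d + e ≡ m * m * m →
                a + (m * ℓ * ℓ + m * m * m) ≡ ℓ * ℓ * ℓ + m * m * ℓ + e
    telescope {a} {b} {c} {d} {e} e₁ e₂ e₃ e₄ = begin
      a + (m * ℓ * ℓ + m * m * m)              ≡⟨ cong₂ (λ x y → a + (x + y)) e₂ e₄ ⟨
      a + ((b + c) + (d + e))                  ≡⟨ regroup a b c d e ⟩
      (a + b) + (c + d) + e                    ≡⟨ cong₂ (λ x y → x + y + e) e₁ e₃ ⟩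
      ℓ * ℓ * ℓ + m * m * ℓ + e                ∎
      where
      open ≡-Reasoning
      regroup : ∀ a b c d e → a + ((b + c) + (d + e)) ≡ (a + b) + (c + d) + e
      regroup = solve-∀

  module _ {k} (T≡2^k : length T ≡ 2 ^ k) where

    numQuads-partition : 4 * numQuads S + F (length C) ≡ 4 * numQuads C + F (length S)
    numQuads-partition = *-cancelˡ-≡ _ _ 6 (combine (orderedQuads S) (orderedQuads C) (numQuads S) (numQuads C)
        (length S) (length C) (F (length S)) (F (length C))
      (subst (λ q → orderedQuads S + 2 * length S ≡ 24 * q + 3 * (length S * length S))
             (sym (numQuads≡countSubsetsWithSum S)) (orderedQuads-count S S-unique))
      (subst (λ q → orderedQuads C + 2 * length C ≡ 24 * q + 3 * (length C * length C))
             (sym (numQuads≡countSubsetsWithSum C)) (orderedQuads-count C C-unique))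
      orderedQuads-partition
      (balance-symmetric k (length S) (length C) (trans (sym length-partition) T≡2^k)))
      where
      combine : ∀ NS NC qS qC ℓ m Fℓ Fm →
        NS + 2 * ℓ ≡ 24 * qS + 3 * (ℓ * ℓ) → NC + 2 * m ≡ 24 * qC + 3 * (m * m) →
        NS + (m * ℓ * ℓ + m * m * m) ≡ ℓ * ℓ * ℓ + m * m * ℓ + NC →
        6 * Fℓ + (3 * (ℓ * ℓ) + 2 * m + m * (ℓ * ℓ) + m * (m * m)) ≡ 6 * Fm + (3 * (m * m) + 2 * ℓ + ℓ * (m * m) + ℓ * (ℓ * ℓ)) →
        6 * (4 * qS + Fm) ≡ 6 * (4 * qC + Fℓ)
      combine NS NC qS qC ℓ m Fℓ Fm h₁ h₂ h₃ h₄ = +-cancelʳ-≡ R _ _ (begin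
        6 * (4 * qS + Fm) + R
          ≡⟨ expand₁ NS NC qS qC ℓ m Fℓ Fm ⟩
        (24 * qS + 3 * (ℓ * ℓ)) + (NC + 2 * m) + (NS + (m * ℓ * ℓ + m * m * m)) +
          (6 * Fm + (3 * (m * m) + 2 * ℓ + ℓ * (m * m) + ℓ * (ℓ * ℓ)))
          ≡⟨ cong₂ _+_ (cong₂ _+_ (cong₂ _+_ (sym h₁) h₂) h₃) (sym h₄) ⟩
        (NS + 2 * ℓ) + (24 * qC + 3 * (m * m)) + (ℓ * ℓ * ℓ + m * m * ℓ + NC) +
          (6 * Fℓ + (3 * (ℓ * ℓ) + 2 * m + m * (ℓ * ℓ) + m * (m * m)))
          ≡⟨ expand₂ NS NC qS qC ℓ m Fℓ Fm ⟩
        6 * (4 * qC + Fℓ) + R ∎)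
        where
        open ≡-Reasoning
        R = NS + NC + 2 * ℓ + 2 * m + 3 * (ℓ * ℓ) + 3 * (m * m) + ℓ * ℓ * ℓ + m * m * ℓ + m * ℓ * ℓ + m * m * m
        expand₁ : ∀ NS NC qS qC ℓ m Fℓ Fm →
          6 * (4 * qS + Fm) + (NS + NC + 2 * ℓ + 2 * m + 3 * (ℓ * ℓ) + 3 * (m * m) + ℓ * ℓ * ℓ + m * m * ℓ + m * ℓ * ℓ + m * m * m) ≡
          (24 * qS + 3 * (ℓ * ℓ)) + (NC + 2 * m) + (NS + (m * ℓ * ℓ + m * m * m)) +
          (6 * Fm + (3 * (m * m) + 2 * ℓ + ℓ * (m * m) + ℓ * (ℓ * ℓ)))
        expand₁ = solve-∀
        expand₂ : ∀ NS NC qS qC ℓ m Fℓ Fm →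
          (NS + 2 * ℓ) + (24 * qC + 3 * (m * m)) + (ℓ * ℓ * ℓ + m * m * ℓ + NC) +
          (6 * Fℓ + (3 * (ℓ * ℓ) + 2 * m + m * (ℓ * ℓ) + m * (m * m))) ≡
          6 * (4 * qC + Fℓ) + (NS + NC + 2 * ℓ + 2 * m + 3 * (ℓ * ℓ) + 3 * (m * m) + ℓ * ℓ * ℓ + m * m * ℓ + m * ℓ * ℓ + m * m * m)
        expand₂ = solve-∀

    numQuads-partition-≤ : 4 * numQuads C ≤ F (length C) → 4 * numQuads S ≤ F (length S)
    numQuads-partition-≤ C≤ = +-cancelʳ-≤ (F (length C)) _ _ (begin
      4 * numQuads S + F (length C)   ≡⟨ numQuads-partition ⟩
      4 * numQuads C + F (length S)   ≤⟨ +-monoˡ-≤ (F (length S)) C≤ ⟩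
      F (length C) + F (length S)     ≡⟨ +-comm (F (length C)) (F (length S)) ⟩
      F (length S) + F (length C)     ∎)
      where open ≤-Reasoning

    numQuads-partition-≡ : 4 * numQuads S ≡ F (length S) → 4 * numQuads C ≡ F (length C)
    numQuads-partition-≡ S≡ = +-cancelʳ-≡ (F (length S)) _ _ (begin
      4 * numQuads C + F (length S)   ≡⟨ numQuads-partition ⟨
      4 * numQuads S + F (length C)   ≡⟨ cong (_+ F (length C)) S≡ ⟩
      F (length S) + F (length C)     ≡⟨ +-comm (F (length S)) (F (length C)) ⟩
      F (length C) + F (length S)     ∎)
      where open ≡-Reasoning

complete⇒closed : {T : List (Card n)} → Complete T → Closed T
complete⇒closed {T = T} T-complete {a} {b} {c} a∈T b∈T c∈T with a ≟ b | a ≟ c | b ≟ c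
... | yes refl | _        | _        = subst (_∈ T) (sym (⊕-cancelˡ a c)) c∈T
... | no _     | yes refl | _        = subst (_∈ T) (sym (trans (cong (a ⊕_) (⊕-comm b a)) (⊕-cancelˡ a b))) b∈T
... | no _     | no _     | yes refl = subst (_∈ T) (sym (trans (cong (a ⊕_) (⊕-self b)) (⊕-identityʳ a))) a∈T
... | no a≢b   | no a≢c   | no b≢c   = T-complete a b c a∈T b∈T c∈T a≢b a≢c b≢c

-- Extremal sets

cube : ∀ n → List (Card n)
cube zero    = [] ∷ []
cube (suc n) = map (false ∷_) (cube n) ++ map (true ∷_) (cube n)

∈-cube : (x : Card n) → x ∈ cube n
∈-cube []          = here refl
∈-cube (false ∷ x) = ∈-++⁺ˡ (∈-map⁺ (false ∷_) (∈-cube x))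
∈-cube (true ∷ x)  = ∈-++⁺ʳ _ (∈-map⁺ (true ∷_) (∈-cube x))

cube-unique : ∀ n → Unique (cube n)
cube-unique zero    = All.[] ∷ []
cube-unique (suc n) = ++⁺ (map⁺ ∷-injectiveʳ (cube-unique n)) (map⁺ ∷-injectiveʳ (cube-unique n)) heads-differ
  where
  heads-differ : ∀ {v} → ¬ (v ∈ map (false ∷_) (cube n) × v ∈ map (true ∷_) (cube n))
  heads-differ (v∈₀ , v∈₁) with ∈-map⁻ (false ∷_) v∈₀ | ∈-map⁻ (true ∷_) v∈₁
  ... | _ , _ , refl | _ , _ , ()

length-cube : ∀ n → length (cube n) ≡ 2 ^ n
length-cube zero    = refl
length-cube (suc n) = begin
  length (map (false ∷_) (cube n) ++ map (true ∷_) (cube n))        ≡⟨ length-++ (map (false ∷_) (cube n)) ⟩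
  length (map (false ∷_) (cube n)) + length (map (true ∷_) (cube n)) ≡⟨ cong₂ _+_ (length-map _ (cube n)) (length-map _ (cube n)) ⟩
  length (cube n) + length (cube n)                                  ≡⟨ cong₂ _+_ (length-cube n) (trans (length-cube n) (sym (+-identityʳ _))) ⟩
  2 ^ suc n                                                          ∎
  where open ≡-Reasoning

cube-closed : Closed (cube n)
cube-closed _ _ _ = ∈-cube _

mult-filter-accept : {P : Card n → Set} (P? : Decidable P) {x : Card n} (L : List (Card n)) → P x → mult (filter P? L) x ≡ mult L x
mult-filter-accept P?     []      _  = refl
mult-filter-accept P? {x} (y ∷ L) Px with P? y
... | yes _   = cong (δ y x +_) (mult-filter-accept P? L Px)
... | no ¬Py  = trans (mult-filter-accept P? L Px) (cong (_+ mult L x) (sym (δ-≢ (λ { refl → ¬Py Px }))))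

mult-filter-reject : {P : Card n → Set} (P? : Decidable P) {x : Card n} (L : List (Card n)) → ¬ P x → mult (filter P? L) x ≡ 0
mult-filter-reject P?     []      _   = refl
mult-filter-reject P? {x} (y ∷ L) ¬Px with P? y
... | yes Py = cong₂ _+_ (δ-≢ (λ { refl → ¬Px Py })) (mult-filter-reject P? L ¬Px)
... | no _   = mult-filter-reject P? L ¬Px

_∖_ : List (Card n) → List (Card n) → List (Card n)
T ∖ S = filter (λ x → ¬? (x ∈? S)) T
  where open DecMembership _≟_

complement-partition : {T S : List (Card n)} → Unique T → Closed T → Unique S → All.All (_∈ T) S →
                       ClosedPartition T S (T ∖ S)
complement-partition {T = T} {S} T! T-closed S! S⊆T = record
  { T-unique = T! ; T-closed = T-closed ; S-unique = S! ; C-unique = filter⁺ (λ x → ¬? (x ∈? S)) T! ; mult-split = split }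
  where
  open DecMembership _≟_
  split : ∀ x → mult T x ≡ mult S x + mult (T ∖ S) x
  split x with x ∈? S
  ... | yes x∈S = begin
    mult T x                     ≡⟨ mult-∈ T! (All.lookup S⊆T x∈S) ⟩
    1                            ≡⟨ mult-∈ S! x∈S ⟨
    mult S x                     ≡⟨ +-identityʳ (mult S x) ⟨
    mult S x + 0                 ≡⟨ cong (mult S x +_) (mult-filter-reject (λ y → ¬? (y ∈? S)) T (λ x∉S → x∉S x∈S)) ⟨
    mult S x + mult (T ∖ S) x    ∎
    where open ≡-Reasoning
  ... | no x∉S = begin
    mult T x                     ≡⟨ mult-filter-accept (λ y → ¬? (y ∈? S)) T x∉S ⟨
    mult (T ∖ S) x               ≡⟨ cong (_+ mult (T ∖ S) x) (mult-∉ S x∉S) ⟨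
    mult S x + mult (T ∖ S) x    ∎
    where open ≡-Reasoning

embed : List (Card n) → List (Card (suc n))
embed = map (false ∷_)

countSubsetsWithSum-embed : ∀ k (v : Card n) X → countSubsetsWithSum k (false ∷ v) (embed X) ≡ countSubsetsWithSum k v X
countSubsetsWithSum-embed zero    v X       = δ-∷ false v 𝟘
countSubsetsWithSum-embed (suc k) v []      = refl
countSubsetsWithSum-embed (suc k) v (x ∷ X) =
  cong₂ _+_ (countSubsetsWithSum-embed k (v ⊕ x) X) (countSubsetsWithSum-embed (suc k) v X)

numQuads-embed : (X : List (Card n)) → numQuads (embed X) ≡ numQuads X
numQuads-embed X = begin
  numQuads (embed X)                        ≡⟨ numQuads≡countSubsetsWithSum (embed X) ⟩
  countSubsetsWithSum 4 (false ∷ 𝟘) (embed X) ≡⟨ countSubsetsWithSum-embed 4 𝟘 X ⟩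
  countSubsetsWithSum 4 𝟘 X                 ≡⟨ numQuads≡countSubsetsWithSum X ⟨
  numQuads X                                ∎
  where open ≡-Reasoning

Extremal : ℕ → ℕ → Set
Extremal k ℓ = Σ (List (Card k)) λ S → Unique S × length S ≡ ℓ × 4 * numQuads S ≡ F ℓ

embed-extremal : ∀ {k ℓ} → Extremal k ℓ → Extremal (suc k) ℓ
embed-extremal (S , S! , |S|≡ℓ , 4q≡F) =
  embed S , map⁺ ∷-injectiveʳ S! , trans (length-map _ S) |S|≡ℓ , trans (cong (4 *_) (numQuads-embed S)) 4q≡F

complement-extremal : ∀ {k ℓ} → ℓ ≤ 2 ^ k → Extremal k (2 ^ k ∸ ℓ) → Extremal k ℓ
complement-extremal {k} {ℓ} ℓ≤2^k (C , C! , |C|≡ , 4q≡F) =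
  cube k ∖ C , ClosedPartition.C-unique P , |cube∖C|≡ℓ ,
  trans (numQuads-partition-≡ P {k} (length-cube k) (subst (λ m → 4 * numQuads C ≡ F m) (sym |C|≡) 4q≡F))
        (cong F |cube∖C|≡ℓ)
  where
  P : ClosedPartition (cube k) C (cube k ∖ C)
  P = complement-partition (cube-unique k) cube-closed C! (All.tabulate (λ {x} _ → ∈-cube x))
  |cube∖C|≡ℓ : length (cube k ∖ C) ≡ ℓ
  |cube∖C|≡ℓ = +-cancelˡ-≡ (2 ^ k ∸ ℓ) _ _ (begin
    2 ^ k ∸ ℓ + length (cube k ∖ C)   ≡⟨ cong (_+ length (cube k ∖ C)) |C|≡ ⟨
    length C + length (cube k ∖ C)    ≡⟨ length-partition P ⟨
    length (cube k)                   ≡⟨ length-cube k ⟩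
    2 ^ k                             ≡⟨ m∸n+n≡m ℓ≤2^k ⟨
    2 ^ k ∸ ℓ + ℓ                     ∎)
    where open ≡-Reasoning

extremal : ∀ k ℓ → ℓ ≤ 2 ^ k → Extremal k ℓ
extremal zero    zero          _         = [] , [] , refl , refl
extremal zero    (suc zero)    _         = ([] ∷ []) , (All.[] ∷ []) , refl , refl
extremal zero    (suc (suc ℓ)) (s≤s ())
extremal (suc k) ℓ             ℓ≤2^k+1 with ℓ ≤? 2 ^ k
... | yes ℓ≤2^k = embed-extremal (extremal k ℓ ℓ≤2^k)
... | no ℓ≰2^k  = complement-extremal ℓ≤2^k+1 (embed-extremal (extremal k (2 ^ suc k ∸ ℓ) rest≤2^k))
  where
  rest≤2^k : 2 ^ suc k ∸ ℓ ≤ 2 ^ k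
  rest≤2^k = begin
    2 ^ suc k ∸ ℓ                  ≤⟨ ∸-monoʳ-≤ (2 ^ suc k) (<⇒≤ (≰⇒> ℓ≰2^k)) ⟩
    2 ^ suc k ∸ 2 ^ k              ≡⟨ cong (_∸ 2 ^ k) (cong (2 ^ k +_) (+-identityʳ (2 ^ k))) ⟩
    2 ^ k + 2 ^ k ∸ 2 ^ k          ≡⟨ m+n∸m≡n (2 ^ k) (2 ^ k) ⟩
    2 ^ k                          ∎
    where open ≤-Reasoning

-- The upper bound

power-of-two-between : ∀ ℓ → ∃ λ k → suc ℓ ≤ 2 ^ k × 2 ^ k < 2 * suc ℓ
power-of-two-between zero = 0 , s≤s z≤n , s≤s (s≤s z≤n)
power-of-two-between (suc ℓ) with power-of-two-between ℓ
... | k , ℓ+1≤2^k , 2^k<2ℓ+2 with suc (suc ℓ) ≤? 2 ^ k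
...   | yes ℓ+2≤2^k = k , ℓ+2≤2^k , <-trans 2^k<2ℓ+2 (*-monoʳ-< 2 (n<1+n (suc ℓ)))
...   | no ℓ+2≰2^k  = suc k , subst (λ p → suc (suc ℓ) ≤ 2 * p) (sym 2^k≡ℓ+1) ℓ+2≤2ℓ+2 ,
                        subst (λ p → 2 * p < 2 * suc (suc ℓ)) (sym 2^k≡ℓ+1) (*-monoʳ-< 2 (n<1+n (suc ℓ)))
  where
  2^k≡ℓ+1 : 2 ^ k ≡ suc ℓ
  2^k≡ℓ+1 = ≤-antisym (≤-pred (≰⇒> ℓ+2≰2^k)) ℓ+1≤2^k
  ℓ+2≤2ℓ+2 : suc (suc ℓ) ≤ 2 * suc ℓ
  ℓ+2≤2ℓ+2 = ≤-trans (m≤m+n (suc (suc ℓ)) ℓ) (≤-reflexive (shape ℓ))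
    where
    shape : ∀ ℓ → suc (suc ℓ) + ℓ ≡ 2 * suc ℓ
    shape = solve-∀

2^⌈log₂⌉<2* : ∀ ℓ → 2 ^ ⌈log₂ suc ℓ ⌉ < 2 * suc ℓ
2^⌈log₂⌉<2* ℓ with power-of-two-between ℓ
... | k , ℓ+1≤2^k , 2^k<2ℓ+2 =
  ≤-<-trans (^-monoʳ-≤ 2 (subst (⌈log₂ suc ℓ ⌉ ≤_) (⌈log₂2^n⌉≡n k) (⌈log₂⌉-mono-≤ ℓ+1≤2^k))) 2^k<2ℓ+2

UpperBound : ℕ → Set
UpperBound ℓ = ∀ n → 2 ^ n ≥ ℓ → (S : List (Card n)) → Unique S → length S ≡ ℓ → 4 * numQuads S ≤ F ℓ

upperBound⇒IsQ : ∀ ℓ → UpperBound ℓ → ∃ λ q → IsQ ℓ q × 4 * q ≡ F ℓ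
upperBound⇒IsQ ℓ bound with extremal ℓ ℓ (<⇒≤ (n<2^n ℓ))
... | E , E! , |E|≡ℓ , 4q≡F =
  numQuads E , ((ℓ , <⇒≤ (n<2^n ℓ) , E , E! , |E|≡ℓ , refl) , maximal) , 4q≡F
  where
  maximal : ∀ n → 2 ^ n ≥ ℓ → (S : List (Card n)) → Unique S → length S ≡ ℓ → numQuads S ≤ numQuads E
  maximal n 2^n≥ℓ S S! |S|≡ℓ = *-cancelˡ-≤ 4 (subst (4 * numQuads S ≤_) (sym 4q≡F) (bound n 2^n≥ℓ S S! |S|≡ℓ))

upperBound : HypH → ∀ ℓ → UpperBound ℓ
upperBound H = <-rec UpperBound step
  where
  step : ∀ ℓ → (∀ {m} → m < ℓ → UpperBound m) → UpperBound ℓ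
  step zero    _  n _      []      _  _     = z≤n
  step (suc ℓ) IH n 2^n≥ℓ+1 S S! |S|≡ℓ+1 =
    -- The bound is decidable, so we may split on whether S has a complete superset of size 2^⌈log₂ (ℓ + 1)⌉.
    decidable-stable (4 * numQuads S ≤? F (suc ℓ)) (λ ¬bound → ¬bound (no-superset (λ sup → ¬bound (superset sup))))
    where
    Superset = ∃ λ (T : List (Card n)) → Unique T × length T ≡ 2 ^ ⌈log₂ suc ℓ ⌉ × Complete T × All.All (_∈ T) S
    superset : Superset → 4 * numQuads S ≤ F (suc ℓ)
    superset (T , T! , |T|≡ , T-complete , S⊆T) =
      subst (λ m → 4 * numQuads S ≤ F m) |S|≡ℓ+1
        (numQuads-partition-≤ P {⌈log₂ suc ℓ ⌉} |T|≡ (IH |C|<ℓ+1 n (≤-trans (<⇒≤ |C|<ℓ+1) 2^n≥ℓ+1) (T ∖ S) (ClosedPartition.C-unique P) refl))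
      where
      P = complement-partition T! (complete⇒closed T-complete) S! S⊆T
      |C|<ℓ+1 : length (T ∖ S) < suc ℓ
      |C|<ℓ+1 = +-cancelˡ-< (suc ℓ) _ _ (begin-strict
        suc ℓ + length (T ∖ S)         ≡⟨ cong (_+ length (T ∖ S)) |S|≡ℓ+1 ⟨
        length S + length (T ∖ S)      ≡⟨ length-partition P ⟨
        length T                       ≡⟨ |T|≡ ⟩
        2 ^ ⌈log₂ suc ℓ ⌉              <⟨ 2^⌈log₂⌉<2* ℓ ⟩
        2 * suc ℓ                      ≡⟨ cong (suc ℓ +_) (+-identityʳ (suc ℓ)) ⟩
        suc ℓ + suc ℓ                  ∎)
        where open ≤-Reasoning
    no-superset : ¬ Superset → 4 * numQuads S ≤ F (suc ℓ)
    no-superset ¬sup with upperBound⇒IsQ ℓ (IH ≤-refl)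
    ... | q , isQ , 4q≡F = begin
      4 * numQuads S     ≤⟨ *-monoʳ-≤ 4 (H (suc ℓ) (s≤s z≤n) n 2^n≥ℓ+1 S S! |S|≡ℓ+1 ¬sup q isQ) ⟩
      4 * q              ≡⟨ 4q≡F ⟩
      F ℓ                ≤⟨ m≤m+n (F ℓ) (ℓ * ℓ ∸ B ℓ) ⟩
      F (suc ℓ)          ∎
      where open ≤-Reasoning

IsQ⇒4q≡F : HypH → ∀ {ℓ q} → IsQ ℓ q → 4 * q ≡ F ℓ
IsQ⇒4q≡F H {ℓ} {q} ((n , 2^n≥ℓ , S , S! , |S|≡ℓ , q≡) , maximal) with extremal ℓ ℓ (<⇒≤ (n<2^n ℓ))
... | E , E! , |E|≡ℓ , 4qE≡F = ≤-antisym
  (subst (λ q → 4 * q ≤ F ℓ) q≡ (upperBound H ℓ n 2^n≥ℓ S S! |S|≡ℓ))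
  (subst (_≤ 4 * q) 4qE≡F (*-monoʳ-≤ 4 (maximal ℓ (<⇒≤ (n<2^n ℓ)) E E! |E|≡ℓ)))

mainTheorem9 : HypH → ∀ (n q₀ q₁ : ℕ) → IsQ n q₀ → IsQ (suc n) q₁ →
    4 * q₁ + B n ≡ 4 * q₀ + n * n
mainTheorem9 H n q₀ q₁ isQ₀ isQ₁ = begin
  4 * q₁ + B n        ≡⟨ cong (_+ B n) (IsQ⇒4q≡F H isQ₁) ⟩
  F (suc n) + B n     ≡⟨ F-suc n ⟩
  F n + n * n         ≡⟨ cong (_+ n * n) (IsQ⇒4q≡F H isQ₀) ⟨
  4 * q₀ + n * n      ∎
  where open ≡-Reasoning
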